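{- Let $p|N$ and suppose that $\tau \in \operatorname{GL}_2({\mathbb Z}_p)$ satisfies $w_p(\tau)>0$. Then there exists $n \in N({\mathbb Q}_p)$ such that for all $y_1, y_2 \in {\mathbb Z}_p^\times$ and $\gamma\in K_0(p^{n_p})$, the element $\sigma \in \operatorname{GL}_2({\mathbb Q}_p)$ defined via $$\sigma= \gamma\begin{pmatrix}0&-1\\ p^{n_p}&0\end{pmatrix} \tau n \begin{pmatrix} y_1p^{ -c_p(\tau)} &0\\0&y_2p^{c_p(\tau)-n_p}\end{pmatrix}$$ has the following properties: (1) $\sigma \in \operatorname{GL}_2({\mathbb Z}_p)$; (2) $c_p(\sigma)=n_p-c_p(\tau)$.
   Context: Let $N=\prod_p p^{n_p}$ be a positive integer. For a prime $p$, let $K_0(p^{n_p}) = \operatorname{GL}_2({\mathbb Z}_p) \cap \begin{pmatrix} {\mathbb Z}_p & {\mathbb Z}_p \\ p^{n_p}{\mathbb Z}_p & {\mathbb Z}_p \end{pmatrix}$ and $N({\mathbb Q}_p)=\{\begin{pmatrix}1&x\\ 0&1\end{pmatrix}: x\in{\mathbb Q}_p\}$. For $\tau = \begin{pmatrix} a & b \\ c & d\end{pmatrix} \in \operatorname{GL}_2({\mathbb Z}_p)$ define $c_p(\tau) = \min(v_p(c), n_p)$ and $w_p(\tau) = \max(n_p - 2c_p(\tau), 0)$. -}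

module Defs where

open import Data.Nat as ℕ using (ℕ; zero; suc; _∸_; _≤_)
open import Data.Integer as ℤ using (ℤ; +_; _+_; _*_; -_; _-_)
open import Data.Integer.Divisibility.Signed
  using (_∣_; divides; _∣?_; ∣m∣n⇒∣m+n; ∣n⇒∣m*n; ∣m⇒∣m*n; ∣m⇒∣-m)
open import Data.Integer.Tactic.RingSolver using (solve-∀)
open import Data.Product using (_×_; _,_)
open import Relation.Binary.PropositionalEquality using (_≡_; subst; sym)
open import Relation.Nullary using (¬_; yes; no; Dec)
open import Data.Nat.Divisibility using () renaming (_∣_ to _ℕ∣_; _∣?_ to _ℕ∣?_)

-- The p-adic integers ℤ_p, modelled as the inverse limit of ℤ/p^k:
-- an element is a sequence (a_k)_k of integers, a_k representing the
-- class of the element modulo p^k, with a_{k+1} ≡ a_k (mod p^k).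

_^ᶻ_ : ℤ → ℕ → ℤ
x ^ᶻ zero = + 1
x ^ᶻ suc k = x * (x ^ᶻ k)

private
  mulId : ∀ a a' b b' → a' * b' - a * b ≡ a' * (b' - b) + (a' - a) * b
  mulId = solve-∀
  addId : ∀ a a' b b' → (a' + b') - (a + b) ≡ (a' - a) + (b' - b)
  addId = solve-∀
  negId : ∀ a a' → (- a') - (- a) ≡ - (a' - a)
  negId = solve-∀
  zeroId' : ∀ c d → c - c ≡ + 0 * d
  zeroId' = solve-∀

module _ (p : ℕ) where

  P : ℤ
  P = + p

  record ℤₚ : Set where
    constructor mkℤₚ
    field
      seq : ℕ → ℤ
      coh : ∀ k → (P ^ᶻ k) ∣ (seq (suc k) - seq k)
  open ℤₚ public

  ι : ℤ → ℤₚ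
  ι c = mkℤₚ (λ _ → c) (λ k → divides (+ 0) (zeroId' c (P ^ᶻ k)))


  _+ₚ_ : ℤₚ → ℤₚ → ℤₚ
  a +ₚ b = mkℤₚ (λ k → seq a k + seq b k)
    (λ k → subst ((P ^ᶻ k) ∣_) (sym (addId (seq a k) (seq a (suc k)) (seq b k) (seq b (suc k))))
             (∣m∣n⇒∣m+n (coh a k) (coh b k)))

  _*ₚ_ : ℤₚ → ℤₚ → ℤₚ
  a *ₚ b = mkℤₚ (λ k → seq a k * seq b k)
    (λ k → subst ((P ^ᶻ k) ∣_) (sym (mulId (seq a k) (seq a (suc k)) (seq b k) (seq b (suc k))))
             (∣m∣n⇒∣m+n (∣n⇒∣m*n (seq a (suc k)) (coh b k)) (∣m⇒∣m*n (seq b k) (coh a k))))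

  -ₚ_ : ℤₚ → ℤₚ
  -ₚ a = mkℤₚ (λ k → - seq a k)
    (λ k → subst ((P ^ᶻ k) ∣_) (sym (negId (seq a k) (seq a (suc k)))) (∣m⇒∣-m (coh a k)))

  p^_∣ₚ_ : ℕ → ℤₚ → Set
  p^ d ∣ₚ a = (P ^ᶻ d) ∣ seq a d

  IsUnitₚ : ℤₚ → Set
  IsUnitₚ a = ¬ (p^ 1 ∣ₚ a)

  -- ℚ_p = ℤ_p[1/p]: the pair (m , a) stands for a / p^m.
  record ℚₚ : Set where
    constructor _/p^_
    field
      numer : ℤₚ
      denExp : ℕ
  open ℚₚ public

  ℤₚ→ℚₚ : ℤₚ → ℚₚ
  ℤₚ→ℚₚ a = a /p^ 0

  _+q_ : ℚₚ → ℚₚ → ℚₚ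
  (a /p^ m) +q (b /p^ k) = ((a *ₚ ι (P ^ᶻ k)) +ₚ (b *ₚ ι (P ^ᶻ m))) /p^ (m ℕ.+ k)

  _*q_ : ℚₚ → ℚₚ → ℚₚ
  (a /p^ m) *q (b /p^ k) = (a *ₚ b) /p^ (m ℕ.+ k)

  -q_ : ℚₚ → ℚₚ
  -q (a /p^ m) = (-ₚ a) /p^ m

  p^_∣q_ : ℕ → ℚₚ → Set
  p^ d ∣q (a /p^ m) = p^ (m ℕ.+ d) ∣ₚ a

  IsIntegral : ℚₚ → Set
  IsIntegral q = p^ 0 ∣q q

  IsUnitq : ℚₚ → Set
  IsUnitq q = p^ 0 ∣q q × ¬ (p^ 1 ∣q q)

record Mat (A : Set) : Set where
  constructor mat
  field
    m₁₁ m₁₂ m₂₁ m₂₂ : A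
open Mat public

mapMat : {A B : Set} → (A → B) → Mat A → Mat B
mapMat f (mat a b c d) = mat (f a) (f b) (f c) (f d)

module _ (p : ℕ) where

  detₚ : Mat (ℤₚ p) → ℤₚ p
  detₚ (mat a b c d) = _+ₚ_ p (_*ₚ_ p a d) (-ₚ_ p (_*ₚ_ p b c))

  detq : Mat (ℚₚ p) → ℚₚ p
  detq (mat a b c d) = _+q_ p (_*q_ p a d) (-q_ p (_*q_ p b c))

  _·_ : Mat (ℚₚ p) → Mat (ℚₚ p) → Mat (ℚₚ p)
  mat a b c d · mat a' b' c' d' =
    mat (a ⊗ a' ⊕ b ⊗ c') (a ⊗ b' ⊕ b ⊗ d') (c ⊗ a' ⊕ d ⊗ c') (c ⊗ b' ⊕ d ⊗ d')
    where _⊗_ = _*q_ p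
          _⊕_ = _+q_ p
          infixl 7 _⊗_
          infixl 6 _⊕_
  infixl 7 _·_

  GL₂ℤₚ : Mat (ℤₚ p) → Set
  GL₂ℤₚ τ = IsUnitₚ p (detₚ τ)

  InGL₂ℤₚ : Mat (ℚₚ p) → Set
  InGL₂ℤₚ σ = IsIntegral p (m₁₁ σ) × IsIntegral p (m₁₂ σ)
            × IsIntegral p (m₂₁ σ) × IsIntegral p (m₂₂ σ)
            × IsUnitq p (detq σ)

  K₀ : ℕ → Mat (ℤₚ p) → Set
  K₀ n γ = GL₂ℤₚ γ × p^_∣ₚ_ p n (m₂₁ γ)

-- largest k ≤ n satisfying a decidable predicate (0 if none)
maxUpTo : (Q : ℕ → Set) → (∀ k → Dec (Q k)) → ℕ → ℕ
maxUpTo Q Q? zero = zero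
maxUpTo Q Q? (suc n) with Q? (suc n)
... | yes _ = suc n
... | no _ = maxUpTo Q Q? n

module _ (p : ℕ) where

  -- c_p(τ) = min(v_p(c), n)  =  largest k ≤ n with p^k ∣ c
  cₚ : ℕ → Mat (ℤₚ p) → ℕ
  cₚ n τ = maxUpTo (λ k → p^_∣ₚ_ p k (m₂₁ τ)) (λ k → (P p ^ᶻ k) ∣? seq (m₂₁ τ) k) n

  cq : ℕ → Mat (ℚₚ p) → ℕ
  cq n σ = maxUpTo (λ k → p^_∣q_ p k (m₂₁ σ))
                   (λ k → (P p ^ᶻ (denExp (m₂₁ σ) ℕ.+ k)) ∣? seq (numer (m₂₁ σ)) (denExp (m₂₁ σ) ℕ.+ k)) n

  wₚ : ℕ → Mat (ℤₚ p) → ℕ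
  wₚ n τ = n ∸ 2 ℕ.* cₚ n τ

  -- n_p = v_p(N)  (for N ≥ 1, p ≥ 2 one has v_p(N) ≤ N)
  vₚ : ℕ → ℕ
  vₚ N = maxUpTo (λ k → p ℕ.^ k ℕ∣ N) (λ k → (p ℕ.^ k) ℕ∣? N) N

  ↑ : Mat (ℤₚ p) → Mat (ℚₚ p)
  ↑ = mapMat (ℤₚ→ℚₚ p)

  int : ℤ → ℚₚ p
  int c = ℤₚ→ℚₚ p (ι p c)

  unip : ℚₚ p → Mat (ℚₚ p)
  unip x = mat (int (+ 1)) x (int (+ 0)) (int (+ 1))

  Wₙ : ℕ → Mat (ℚₚ p)
  Wₙ n = mat (int (+ 0)) (int (- + 1)) (int (P p ^ᶻ n)) (int (+ 0))

  diagY : ℕ → ℕ → ℤₚ p → ℤₚ p → Mat (ℚₚ p)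
  diagY n c y₁ y₂ = mat (y₁ /p^ c) (int (+ 0)) (int (+ 0)) (y₂ /p^ (n ∸ c))

  σ : ℕ → Mat (ℤₚ p) → Mat (ℤₚ p) → ℚₚ p → ℤₚ p → ℤₚ p → Mat (ℚₚ p)
  σ n γ τ x y₁ y₂ = _·_ p (_·_ p (_·_ p (_·_ p (↑ γ) (Wₙ n)) (↑ τ)) (unip x)) (diagY n (cₚ n τ) y₁ y₂)

-- Let t = c_p(τ) < n, γ = [[g,e],[f,h]], τ = [[a,b],[c,d]] and
-- s = γ [[0,-1],[p^n,0]] τ = [[e p^n a - g c, e p^n b - g d], [h p^n a - f c, h p^n b - f d]], an integral
-- matrix with det s = p^n det γ det τ whose first column is divisible by p^t. For x = X / p^t the entries of σ
-- are s₁₁ y₁ / p^t, (s₁₁ X + s₁₂ p^t) y₂ / p^n, s₂₁ y₁ / p^t, (s₂₁ X + s₂₂ p^t) y₂ / p^n, and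
-- det σ = y₁ y₂ det s / p^n is a unit. The second column is integral as soon as p^n ∣ c X + d p^t, which is
-- solvable because c = u p^t with u a unit: take X = - d u⁻¹ mod p^n. Finally p^n ∣ f, and when t ≥ 1 the
-- entries h and a are units while p ∣ c, so s₂₁ = h p^n a - f c has valuation exactly n and σ₂₁ valuation n - t.

module Submission where

open import Defs
open import Data.Nat as ℕ using (ℕ; zero; suc; _∸_; _≤_; _<_; _≤′_; ≤′-reflexive; ≤′-step; z≤n; s≤s)
import Data.Nat.Properties as ℕP
open import Data.Nat.Divisibility as ℕ∣ using () renaming (_∣_ to _∣ℕ_)
open import Data.Nat.Coprimality using (Coprime; coprime-Bézout; coprime-divisor)
open import Data.Nat.GCD using (module Bézout)
open import Data.Nat.Primality using (Prime; euclidsLemma; prime⇒irreducible; ¬prime[0])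
open import Data.Integer as ℤ using (ℤ; +_; -[1+_]; _+_; _*_; -_; _-_; ∣_∣)
import Data.Integer.Properties as ℤP
open import Data.Integer.Divisibility.Signed
open import Data.Integer.Tactic.RingSolver using (solve-∀)
open import Data.Product using (Σ; ∃-syntax; _×_; _,_; proj₁; proj₂)
open import Data.Sum using (_⊎_; inj₁; inj₂)
open import Data.Empty using (⊥-elim)
open import Relation.Nullary using (¬_; yes; no)
open import Relation.Binary.PropositionalEquality
open import Function.Bundles using (_⇔_; mk⇔; Equivalence)

maxUpTo-sound : ∀ Q Q? n → maxUpTo Q Q? n ≡ 0 ⊎ Q (maxUpTo Q Q? n)
maxUpTo-sound Q Q? zero = inj₁ refl
maxUpTo-sound Q Q? (suc n) with Q? (suc n)
... | yes q = inj₂ q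
... | no _ = maxUpTo-sound Q Q? n

maxUpTo-maximal : ∀ Q Q? {n k} → maxUpTo Q Q? n < k → k ≤ n → ¬ Q k
maxUpTo-maximal Q Q? {zero} r<k k≤0 = ⊥-elim (ℕP.<⇒≱ r<k k≤0)
maxUpTo-maximal Q Q? {suc n} {k} r<k k≤n with Q? (suc n) | ℕP.m≤n⇒m<n∨m≡n k≤n
... | yes _ | _ = ⊥-elim (ℕP.<⇒≱ r<k k≤n)
... | no ¬q | inj₂ refl = ¬q
... | no _ | inj₁ k<sn = maxUpTo-maximal Q Q? r<k (ℕP.≤-pred k<sn)

maxUpTo-unique : ∀ Q Q? {n r} → r ≤ n → Q r → (∀ {k} → r < k → k ≤ n → ¬ Q k) → maxUpTo Q Q? n ≡ r
maxUpTo-unique Q Q? {zero} z≤n _ _ = refl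
maxUpTo-unique Q Q? {suc n} {r} r≤n q above with Q? (suc n) | ℕP.m≤n⇒m<n∨m≡n r≤n
... | yes _ | inj₂ r≡sn = sym r≡sn
... | yes qs | inj₁ r<sn = ⊥-elim (above r<sn ℕP.≤-refl qs)
... | no ¬qs | inj₂ refl = ⊥-elim (¬qs q)
... | no _ | inj₁ r<sn = maxUpTo-unique Q Q? (ℕP.≤-pred r<sn) q (λ r<k k≤n → above r<k (ℕP.m≤n⇒m≤1+n k≤n))

coprime-*ˡ : ∀ {m m′ n} → Coprime m n → Coprime m′ n → Coprime (m ℕ.* m′) n
coprime-*ˡ c c′ (d∣mm′ , d∣n) =
  c′ (coprime-divisor (λ (i∣d , i∣m) → c (i∣m , ℕ∣.∣-trans i∣d d∣n)) d∣mm′ , d∣n)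

coprime-^ˡ : ∀ {m n} k → Coprime m n → Coprime (m ℕ.^ k) n
coprime-^ˡ zero c (d∣1 , _) = ℕ∣.∣1⇒≡1 d∣1
coprime-^ˡ (suc k) c = coprime-*ˡ c (coprime-^ˡ k c)

coprime⇒invertibleℕ : ∀ {m A} → Coprime m A → ∃[ w ] + m ∣ + 1 - + A * w
coprime⇒invertibleℕ {m} {A} c with coprime-Bézout c
... | Bézout.+- x y eq = - + y , divides (+ x) (begin
  + 1 - + A * - + y  ≡⟨ ring (+ A) (+ y) ⟩
  + 1 + + y * + A    ≡⟨ cong (λ v → + 1 + v) (ℤP.pos-* y A) ⟨
  + (1 ℕ.+ y ℕ.* A)  ≡⟨ cong +_ eq ⟩
  + (x ℕ.* m)        ≡⟨ ℤP.pos-* x m ⟩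
  + x * + m          ∎)
  where open ≡-Reasoning
        ring : ∀ a b → + 1 - a * - b ≡ + 1 + b * a
        ring = solve-∀
... | Bézout.-+ x y eq = + y , divides (- + x) (begin
  + 1 - + A * + y            ≡⟨ cong (λ v → + 1 - v) (ℤP.*-comm (+ A) (+ y)) ⟩
  + 1 - + y * + A            ≡⟨ cong (λ v → + 1 - v) (ℤP.pos-* y A) ⟨
  + 1 - + (y ℕ.* A)          ≡⟨ cong (λ v → + 1 - + v) eq ⟨
  + 1 - + (1 ℕ.+ x ℕ.* m)    ≡⟨ cong (λ v → + 1 - v)
                                   (trans (ℤP.pos-+ 1 (x ℕ.* m)) (cong (λ v → + 1 + v) (ℤP.pos-* x m))) ⟩
  + 1 - (+ 1 + + x * + m)    ≡⟨ ring (+ x) (+ m) ⟩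
  - + x * + m                ∎)
  where open ≡-Reasoning
        ring : ∀ a b → + 1 - (+ 1 + a * b) ≡ - a * b
        ring = solve-∀

coprime⇒invertible : ∀ {m} u → Coprime m ∣ u ∣ → ∃[ w ] + m ∣ + 1 - u * w
coprime⇒invertible (+ A) c = coprime⇒invertibleℕ c
coprime⇒invertible -[1+ A ] c with coprime⇒invertibleℕ c
... | w , m∣ = - w , subst (_ ∣_) (cong (λ v → + 1 - v) (neg-*-neg (+ suc A) w)) m∣
  where neg-*-neg : ∀ a b → a * b ≡ (- a) * (- b)
        neg-*-neg = solve-∀

^ᶻ-distribˡ-+-* : ∀ x m k → x ^ᶻ (m ℕ.+ k) ≡ x ^ᶻ m * x ^ᶻ k
^ᶻ-distribˡ-+-* x zero k = sym (ℤP.*-identityˡ (x ^ᶻ k))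
^ᶻ-distribˡ-+-* x (suc m) k =
  trans (cong (x *_) (^ᶻ-distribˡ-+-* x m k)) (sym (ℤP.*-assoc x (x ^ᶻ m) (x ^ᶻ k)))

^ᶻ-mono-∣ : ∀ x {m k} → m ≤ k → x ^ᶻ m ∣ x ^ᶻ k
^ᶻ-mono-∣ x {m} {k} m≤k = divides (x ^ᶻ (k ∸ m)) (begin
  x ^ᶻ k                  ≡⟨ cong (x ^ᶻ_) (ℕP.m+[n∸m]≡n m≤k) ⟨
  x ^ᶻ (m ℕ.+ (k ∸ m))    ≡⟨ ^ᶻ-distribˡ-+-* x m (k ∸ m) ⟩
  x ^ᶻ m * x ^ᶻ (k ∸ m)   ≡⟨ ℤP.*-comm (x ^ᶻ m) _ ⟩
  x ^ᶻ (k ∸ m) * x ^ᶻ m   ∎)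
  where open ≡-Reasoning

pos-^ : ∀ m k → + (m ℕ.^ k) ≡ (+ m) ^ᶻ k
pos-^ m zero = refl
pos-^ m (suc k) = trans (ℤP.pos-* m (m ℕ.^ k)) (cong (+ m *_) (pos-^ m k))

*-pres-∣ : ∀ {a b x y} → a ∣ x → b ∣ y → a * b ∣ x * y
*-pres-∣ {a} {b} (divides q refl) (divides r refl) = divides (q * r) (ring q a r b)
  where ring : ∀ q a r b → q * a * (r * b) ≡ q * r * (a * b)
        ring = solve-∀

module _ (p : ℕ) where

  P^_ : ℕ → ℤ
  P^ k = P p ^ᶻ k

  IsUnitᶻ : ℤ → Set
  IsUnitᶻ u = ¬ (P^ 1 ∣ u)

  seq-≡-mod : (a : ℤₚ p) {j k : ℕ} → j ≤′ k → P^ j ∣ seq a k - seq a j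
  seq-≡-mod a {j} (≤′-reflexive refl) = divides (+ 0) (ℤP.+-inverseʳ (seq a j))
  seq-≡-mod a {j} (≤′-step {k} j≤′k) = subst (P^ j ∣_) (telescope (seq a (suc k)) (seq a k) (seq a j))
    (∣m∣n⇒∣m+n (∣-trans (^ᶻ-mono-∣ (P p) (ℕP.≤′⇒≤ j≤′k)) (coh a k)) (seq-≡-mod a j≤′k))
    where telescope : ∀ x y z → (x - y) + (y - z) ≡ x - z
          telescope = solve-∀

  ∣ₚ⇒∣seq : (a : ℤₚ p) {j k : ℕ} → j ≤ k → p^_∣ₚ_ p j a → P^ j ∣ seq a k
  ∣ₚ⇒∣seq a {j} {k} j≤k j∣a = subst (P^ j ∣_) (ring (seq a k) (seq a j))
    (∣m∣n⇒∣m+n (seq-≡-mod a (ℕP.≤⇒≤′ j≤k)) j∣a)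
    where ring : ∀ x y → (x - y) + y ≡ x
          ring = solve-∀

  ∣seq⇒∣ₚ : (a : ℤₚ p) {j k : ℕ} → j ≤ k → P^ j ∣ seq a k → p^_∣ₚ_ p j a
  ∣seq⇒∣ₚ a {j} {k} j≤k j∣ak = subst (P^ j ∣_) (ring (seq a k) (seq a j))
    (∣m∣n⇒∣m-n j∣ak (seq-≡-mod a (ℕP.≤⇒≤′ j≤k)))
    where ring : ∀ x y → x - (x - y) ≡ y
          ring = solve-∀

  IsUnitₚ⇒IsUnitᶻ : (a : ℤₚ p) → IsUnitₚ p a → ∀ {k} → 1 ≤ k → IsUnitᶻ (seq a k)
  IsUnitₚ⇒IsUnitᶻ a unit 1≤k p∣ak = unit (∣seq⇒∣ₚ a 1≤k p∣ak)

  ∣q-downward : (q : ℚₚ p) {j k : ℕ} → j ≤ k → p^_∣q_ p k q → p^_∣q_ p j q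
  ∣q-downward (a /p^ m) {j} {k} j≤k k∣q = ∣seq⇒∣ₚ a (ℕP.+-monoʳ-≤ m j≤k)
    (∣-trans (^ᶻ-mono-∣ (P p) (ℕP.+-monoʳ-≤ m j≤k)) k∣q)

  ∣q⇔∣numer : ∀ (q : ℚₚ p) j → p^_∣q_ p j q ⇔ P^ (denExp q ℕ.+ j) ∣ seq (numer q) (denExp q ℕ.+ j)
  ∣q⇔∣numer q j = mk⇔ (λ j∣q → j∣q) (λ j∣q → j∣q)

  IsIntegral-intro : (q : ℚₚ p) {d : ℕ} → denExp q ≡ d → P^ d ∣ seq (numer q) d → IsIntegral p q
  IsIntegral-intro q den≡d = subst (λ k → P^ k ∣ seq (numer q) k) (sym (trans (ℕP.+-identityʳ _) den≡d))

  -- These hold by refl; instantiated at σ they spare Agda from normalising its entries.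
  numer-detq : ∀ (M : Mat (ℚₚ p)) K → seq (numer (detq p M)) K ≡
    seq (numer (m₁₁ M)) K * seq (numer (m₂₂ M)) K * P^ (denExp (m₁₂ M) ℕ.+ denExp (m₂₁ M))
    + - (seq (numer (m₁₂ M)) K * seq (numer (m₂₁ M)) K) * P^ (denExp (m₁₁ M) ℕ.+ denExp (m₂₂ M))
  numer-detq M K = refl

  denExp-detq : ∀ (M : Mat (ℚₚ p)) →
    denExp (detq p M) ≡ (denExp (m₁₁ M) ℕ.+ denExp (m₂₂ M)) ℕ.+ (denExp (m₁₂ M) ℕ.+ denExp (m₂₁ M))
  denExp-detq M = refl

  numer-detq-shape : ∀ (M : Mat (ℚₚ p)) K s₁₁ s₁₂ s₂₁ s₂₂ y z X Pt W →
    seq (numer (m₁₁ M)) K ≡ s₁₁ * y * Pt → seq (numer (m₁₂ M)) K ≡ (s₁₁ * X + s₁₂ * Pt) * z →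
    seq (numer (m₂₁ M)) K ≡ s₂₁ * y * Pt → seq (numer (m₂₂ M)) K ≡ (s₂₁ * X + s₂₂ * Pt) * z →
    P^ (denExp (m₁₂ M) ℕ.+ denExp (m₂₁ M)) ≡ W → P^ (denExp (m₁₁ M) ℕ.+ denExp (m₂₂ M)) ≡ W →
    seq (numer (detq p M)) K ≡ W * (Pt * Pt) * (y * z * (s₁₁ * s₂₂ - s₁₂ * s₂₁))
  numer-detq-shape M K s₁₁ s₁₂ s₂₁ s₂₂ y z X Pt W e₁₁ e₁₂ e₂₁ e₂₂ w₁ w₂ =
    trans (numer-detq M K) (shape e₁₁ e₁₂ e₂₁ e₂₂ w₁ w₂)
    where
      ring : ∀ s₁₁ s₁₂ s₂₁ s₂₂ y z X Pt W →
        s₁₁ * y * Pt * ((s₂₁ * X + s₂₂ * Pt) * z) * W + - ((s₁₁ * X + s₁₂ * Pt) * z * (s₂₁ * y * Pt)) * W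
        ≡ W * (Pt * Pt) * (y * z * (s₁₁ * s₂₂ - s₁₂ * s₂₁))
      ring = solve-∀
      shape : ∀ {N₁₁ N₁₂ N₂₁ N₂₂ W₁ W₂} → N₁₁ ≡ s₁₁ * y * Pt → N₁₂ ≡ (s₁₁ * X + s₁₂ * Pt) * z →
        N₂₁ ≡ s₂₁ * y * Pt → N₂₂ ≡ (s₂₁ * X + s₂₂ * Pt) * z → W₁ ≡ W → W₂ ≡ W →
        N₁₁ * N₂₂ * W₁ + - (N₁₂ * N₂₁) * W₂ ≡ W * (Pt * Pt) * (y * z * (s₁₁ * s₂₂ - s₁₂ * s₂₁))
      shape refl refl refl refl refl refl = ring s₁₁ s₁₂ s₂₁ s₂₂ y z X Pt W

  cₚ-divides : ∀ n τ {K} → cₚ p n τ ≤ K → P^ (cₚ p n τ) ∣ seq (m₂₁ τ) K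
  cₚ-divides n τ {K} t≤K with maxUpTo-sound (λ k → p^_∣ₚ_ p k (m₂₁ τ)) (λ k → (P p ^ᶻ k) ∣? seq (m₂₁ τ) k) n
  ... | inj₁ t≡0 = subst (λ i → P^ i ∣ seq (m₂₁ τ) K) (sym t≡0) (divides (seq (m₂₁ τ) K) (sym (ℤP.*-identityʳ _)))
  ... | inj₂ t∣c = ∣ₚ⇒∣seq (m₂₁ τ) t≤K t∣c

  cₚ-maximal : ∀ n τ → cₚ p n τ < n → ¬ p^_∣ₚ_ p (suc (cₚ p n τ)) (m₂₁ τ)
  cₚ-maximal n τ t<n = maxUpTo-maximal _ _ ℕP.≤-refl t<n

  cq-unique : ∀ (M : Mat (ℚₚ p)) n r → r ≤ n → p^_∣q_ p r (m₂₁ M) →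
              (∀ {k} → r < k → k ≤ n → ¬ p^_∣q_ p k (m₂₁ M)) → cq p n M ≡ r
  cq-unique M n r = maxUpTo-unique _ _

  P^suc : ∀ v → P^ (suc v) ≡ P^ v * P^ 1
  P^suc v = trans (cong (P^_) (ℕP.+-comm 1 v)) (^ᶻ-distribˡ-+-* (P p) v 1)

  module _ (p-prime : Prime p) where

    P^1∣⇒p∣ : ∀ {x} → P^ 1 ∣ x → p ∣ℕ ∣ x ∣
    P^1∣⇒p∣ {x} d = ∣⇒∣ᵤ (subst (_∣ x) (ℤP.*-identityʳ (P p)) d)

    p∣⇒P^1∣ : ∀ {x} → p ∣ℕ ∣ x ∣ → P^ 1 ∣ x
    p∣⇒P^1∣ {x} d = subst (_∣ x) (sym (ℤP.*-identityʳ (P p))) (∣ᵤ⇒∣ d)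

    IsUnitᶻ-* : ∀ {x y} → IsUnitᶻ x → IsUnitᶻ y → IsUnitᶻ (x * y)
    IsUnitᶻ-* {x} {y} ux uy d
      with euclidsLemma ∣ x ∣ ∣ y ∣ p-prime (subst (p ∣ℕ_) (ℤP.abs-* x y) (P^1∣⇒p∣ d))
    ... | inj₁ p∣x = ux (p∣⇒P^1∣ p∣x)
    ... | inj₂ p∣y = uy (p∣⇒P^1∣ p∣y)

    P^-cancelˡ-∣ : ∀ k {x y} → P^ k * x ∣ P^ k * y → x ∣ y
    P^-cancelˡ-∣ k = *-cancelˡ-∣ (P^ k) {{ℤ.≢-nonZero (P^≢0 k)}}
      where
        P^≢0 : ∀ k → P^ k ≢ + 0
        P^≢0 (suc k) P^sk≡0 with ℤP.i*j≡0⇒i≡0∨j≡0 (P p) P^sk≡0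
        ... | inj₁ P≡0 = ¬prime[0] (subst Prime (cong ∣_∣ P≡0) p-prime)
        ... | inj₂ P^k≡0 = P^≢0 k P^k≡0

    quotient-IsUnitᶻ : ∀ {v x} (d : P^ v ∣ x) → ¬ (P^ (suc v) ∣ x) → IsUnitᶻ (quotient d)
    quotient-IsUnitᶻ {v} (divides q refl) ¬sv∣x P∣q =
      ¬sv∣x (subst (_∣ q * P^ v) (trans (ℤP.*-comm (P^ 1) (P^ v)) (sym (P^suc v))) (*-pres-∣ P∣q ∣-refl))

    valuation-*-IsUnitᶻ : ∀ {v x u} → P^ v ∣ x → ¬ (P^ (suc v) ∣ x) → IsUnitᶻ u →
                          ¬ (P^ (suc v) ∣ x * u)
    valuation-*-IsUnitᶻ {v} {x} {u} v∣x@(divides q refl) ¬sv∣x unit-u sv∣xu =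
      IsUnitᶻ-* {q} {u} (quotient-IsUnitᶻ {v} v∣x ¬sv∣x) unit-u
        (P^-cancelˡ-∣ v (subst₂ _∣_ (P^suc v) (ring q (P^ v) u) sv∣xu))
      where ring : ∀ q a u → q * a * u ≡ a * (q * u)
            ring = solve-∀

    IsUnitᶻ⇒invertible : ∀ {u} → IsUnitᶻ u → ∀ k → ∃[ w ] P^ k ∣ + 1 - u * w
    IsUnitᶻ⇒invertible {u} unit-u k with coprime⇒invertible u (coprime-^ˡ k coprime)
      where
        coprime : Coprime p ∣ u ∣
        coprime {i} (i∣p , i∣u) with prime⇒irreducible p-prime i∣p
        ... | inj₁ i≡1 = i≡1
        ... | inj₂ refl = ⊥-elim (unit-u (p∣⇒P^1∣ i∣u))
    ... | w , pᵏ∣ = w , subst (_∣ _) (pos-^ p k) pᵏ∣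

    IsUnitq-intro : (q : ℚₚ p) (u : ℕ → ℤ) → (∀ K → seq (numer q) K ≡ P^ (denExp q) * u K) →
                    (∀ K → 1 ≤ K → IsUnitᶻ (u K)) → IsUnitq p q
    IsUnitq-intro (a /p^ m) u a≡ unit-u =
      subst₂ _∣_ (cong P^_ (sym (ℕP.+-identityʳ m))) (sym (a≡ (m ℕ.+ 0))) (∣m⇒∣m*n (u (m ℕ.+ 0)) ∣-refl) ,
      λ m+1∣a → unit-u (m ℕ.+ 1) (ℕP.m≤n+m 1 m)
        (P^-cancelˡ-∣ m (subst₂ _∣_ (^ᶻ-distribˡ-+-* (P p) m 1) (a≡ (m ℕ.+ 1)) m+1∣a))

    IsUnitᶻ-det⇒IsUnitᶻ-diagonal : ∀ {x₁ x₂ x₃ x₄} → IsUnitᶻ (x₁ * x₂ + - (x₃ * x₄)) → P^ 1 ∣ x₄ →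
                                    IsUnitᶻ x₁ × IsUnitᶻ x₂
    IsUnitᶻ-det⇒IsUnitᶻ-diagonal {x₁} {x₂} {x₃} unit-det P∣x₄ =
      (λ P∣x₁ → unit-det (∣m∣n⇒∣m+n (∣m⇒∣m*n x₂ P∣x₁) x₃x₄)) ,
      (λ P∣x₂ → unit-det (∣m∣n⇒∣m+n (∣n⇒∣m*n x₁ P∣x₂) x₃x₄))
      where x₃x₄ = ∣m⇒∣-m (∣n⇒∣m*n x₃ P∣x₄)

    linear-congruence-solvable : ∀ n τ → cₚ p n τ < n →
      ∃[ X ] P^ n ∣ seq (m₂₁ τ) n * X + seq (m₂₂ τ) n * P^ (cₚ p n τ)
    linear-congruence-solvable n τ t<n = - (d * w) , subst (P^ n ∣_) (sym c·X+d·Pᵗ) (∣n⇒∣m*n (d * P^ t) n∣1-uw)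
      where
        t = cₚ p n τ
        c = seq (m₂₁ τ) n
        d = seq (m₂₂ τ) n
        t∣c : P^ t ∣ c
        t∣c = cₚ-divides n τ (ℕP.<⇒≤ t<n)
        u = quotient t∣c
        unit-u : IsUnitᶻ u
        unit-u = quotient-IsUnitᶻ {t} t∣c (λ st∣c → cₚ-maximal n τ t<n (∣seq⇒∣ₚ (m₂₁ τ) t<n st∣c))
        w = proj₁ (IsUnitᶻ⇒invertible unit-u n)
        n∣1-uw = proj₂ (IsUnitᶻ⇒invertible unit-u n)
        ring : ∀ u Pt d w → u * Pt * - (d * w) + d * Pt ≡ d * Pt * (+ 1 - u * w)
        ring = solve-∀
        c·X+d·Pᵗ : c * - (d * w) + d * P^ t ≡ d * P^ t * (+ 1 - u * w)
        c·X+d·Pᵗ = trans (cong (λ v → v * - (d * w) + d * P^ t) (_∣_.equality t∣c)) (ring u (P^ t) d w)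

    module Twist (n : ℕ) (γ τ : Mat (ℤₚ p)) (X : ℤ) (y₁ y₂ : ℤₚ p) where

      t : ℕ
      t = cₚ p n τ

      S : Mat (ℚₚ p)
      S = σ p n γ τ (ι p X /p^ cₚ p n τ) y₁ y₂

      -- Statements about cq are transported along S≡σ: converting between S and its unfolding under cq
      -- makes Agda run the divisibility decision procedure on the unnormalised numerators.
      S≡σ : S ≡ σ p n γ τ (ι p X /p^ cₚ p n τ) y₁ y₂
      S≡σ = refl

      module _ (K : ℕ) where
        g = seq (m₁₁ γ) K
        e = seq (m₁₂ γ) K
        f = seq (m₂₁ γ) K
        h = seq (m₂₂ γ) K
        a = seq (m₁₁ τ) K
        b = seq (m₁₂ τ) K
        c = seq (m₂₁ τ) K
        d = seq (m₂₂ τ) K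
        y = seq y₁ K
        z = seq y₂ K

        s₁₁ s₁₂ s₂₁ s₂₂ : ℤ
        s₁₁ = e * P^ n * a - g * c
        s₁₂ = e * P^ n * b - g * d
        s₂₁ = h * P^ n * a - f * c
        s₂₂ = h * P^ n * b - f * d

      private
        P^t+0+0 : P^ (t ℕ.+ 0 ℕ.+ 0) ≡ P^ t
        P^t+0+0 = cong P^_ (trans (ℕP.+-identityʳ _) (ℕP.+-identityʳ t))

        -- The numerators of σ as computed by _·_: the factors + 0 and + 1 come from Wₙ, unip and diagY, and
        -- T′, Pt are the powers of p by which _+q_ aligns denominators.
        column₁ : ∀ g e a b c d y Pn T′ Pt X →
          let r₁ = g * + 0 * + 1 + e * Pn * + 1
              r₂ = g * - + 1 * + 1 + e * + 0 * + 1
              u₁ = r₁ * a * + 1 + r₂ * c * + 1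
              u₂ = r₁ * b * + 1 + r₂ * d * + 1
          in (u₁ * + 1 * + 1 + u₂ * + 0 * + 1) * y * T′ + (u₁ * X * + 1 + u₂ * + 1 * Pt) * + 0 * Pt
             ≡ (e * Pn * a - g * c) * y * T′
        column₁ = solve-∀

        column₂ : ∀ g e a b c d z Pn T′ Pt X →
          let r₁ = g * + 0 * + 1 + e * Pn * + 1
              r₂ = g * - + 1 * + 1 + e * + 0 * + 1
              u₁ = r₁ * a * + 1 + r₂ * c * + 1
              u₂ = r₁ * b * + 1 + r₂ * d * + 1
          in (u₁ * + 1 * + 1 + u₂ * + 0 * + 1) * + 0 * T′ + (u₁ * X * + 1 + u₂ * + 1 * Pt) * z * + 1
             ≡ ((e * Pn * a - g * c) * X + (e * Pn * b - g * d) * Pt) * z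
        column₂ = solve-∀

      numer₁₁ : ∀ K → seq (numer (m₁₁ S)) K ≡ s₁₁ K * y K * P^ t
      numer₁₁ K = trans (column₁ (g K) (e K) (a K) (b K) (c K) (d K) (y K) (P^ n) (P^ (t ℕ.+ 0 ℕ.+ 0)) (P^ t) X)
                        (cong (s₁₁ K * y K *_) P^t+0+0)

      numer₂₁ : ∀ K → seq (numer (m₂₁ S)) K ≡ s₂₁ K * y K * P^ t
      numer₂₁ K = trans (column₁ (f K) (h K) (a K) (b K) (c K) (d K) (y K) (P^ n) (P^ (t ℕ.+ 0 ℕ.+ 0)) (P^ t) X)
                        (cong (s₂₁ K * y K *_) P^t+0+0)

      numer₁₂ : ∀ K → seq (numer (m₁₂ S)) K ≡ (s₁₁ K * X + s₁₂ K * P^ t) * z K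
      numer₁₂ K = column₂ (g K) (e K) (a K) (b K) (c K) (d K) (z K) (P^ n) (P^ (t ℕ.+ 0 ℕ.+ (n ∸ t))) (P^ t) X

      numer₂₂ : ∀ K → seq (numer (m₂₂ S)) K ≡ (s₂₁ K * X + s₂₂ K * P^ t) * z K
      numer₂₂ K = column₂ (f K) (h K) (a K) (b K) (c K) (d K) (z K) (P^ n) (P^ (t ℕ.+ 0 ℕ.+ (n ∸ t))) (P^ t) X

      den₁₁ : denExp (m₁₁ S) ≡ t ℕ.+ t
      den₁₁ = cong (t ℕ.+_) (trans (ℕP.+-identityʳ _) (ℕP.+-identityʳ t))

      den₂₁ : denExp (m₂₁ S) ≡ t ℕ.+ t
      den₂₁ = cong (t ℕ.+_) (trans (ℕP.+-identityʳ _) (ℕP.+-identityʳ t))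

      den₁₂ : t ≤ n → denExp (m₁₂ S) ≡ n
      den₁₂ t≤n = trans (cong (ℕ._+ (n ∸ t)) (ℕP.+-identityʳ t)) (ℕP.m+[n∸m]≡n t≤n)

      P^t+t : P^ (t ℕ.+ t) ≡ P^ t * P^ t
      P^t+t = ^ᶻ-distribˡ-+-* (P p) t t

      P^-den : ∀ {m m′ k k′} → m ≡ k → m′ ≡ k′ → P^ (m ℕ.+ m′) ≡ P^ k * P^ k′
      P^-den {m} {m′} refl refl = ^ᶻ-distribˡ-+-* (P p) m m′

      det-s : ∀ K → s₁₁ K * s₂₂ K - s₁₂ K * s₂₁ K ≡ P^ n * (seq (detₚ p γ) K * seq (detₚ p τ) K)
      det-s K = ring (g K) (e K) (f K) (h K) (a K) (b K) (c K) (d K) (P^ n)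
        where ring : ∀ g e f h a b c d Pn →
                (e * Pn * a - g * c) * (h * Pn * b - f * d) - (e * Pn * b - g * d) * (h * Pn * a - f * c)
                ≡ Pn * ((g * h + - (e * f)) * (a * d + - (b * c)))
              ring = solve-∀

      numer-det : t ≤ n → ∀ K → seq (numer (detq p S)) K ≡
                  P^ (denExp (detq p S)) * (y K * z K * (seq (detₚ p γ) K * seq (detₚ p τ) K))
      numer-det t≤n K = begin
        seq (numer (detq p S)) K
          ≡⟨ numer-detq-shape S K (s₁₁ K) (s₁₂ K) (s₂₁ K) (s₂₂ K) (y K) (z K) X (P^ t) W
                              (numer₁₁ K) (numer₁₂ K) (numer₂₁ K) (numer₂₂ K) W₁₂ W₁₁ ⟩
        W * (P^ t * P^ t) * (y K * z K * (s₁₁ K * s₂₂ K - s₁₂ K * s₂₁ K))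
          ≡⟨ cong (λ v → W * (P^ t * P^ t) * (y K * z K * v)) (det-s K) ⟩
        W * (P^ t * P^ t) * (y K * z K * (P^ n * G))
          ≡⟨ ring (P^ t) (P^ n) (y K) (z K) G ⟩
        W * W * (y K * z K * G)
          ≡⟨ cong (_* (y K * z K * G)) (cong₂ _*_ W₁₁ W₁₂) ⟨
        P^ (denExp (m₁₁ S) ℕ.+ denExp (m₂₂ S)) * P^ (denExp (m₁₂ S) ℕ.+ denExp (m₂₁ S)) * (y K * z K * G)
          ≡⟨ cong (_* (y K * z K * G)) P^den ⟨
        P^ (denExp (detq p S)) * (y K * z K * G) ∎
        where
          open ≡-Reasoning
          G = seq (detₚ p γ) K * seq (detₚ p τ) K
          P^den : P^ (denExp (detq p S)) ≡
                  P^ (denExp (m₁₁ S) ℕ.+ denExp (m₂₂ S)) * P^ (denExp (m₁₂ S) ℕ.+ denExp (m₂₁ S))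
          P^den = trans (cong P^_ (denExp-detq S))
                        (^ᶻ-distribˡ-+-* (P p) (denExp (m₁₁ S) ℕ.+ denExp (m₂₂ S)) (denExp (m₁₂ S) ℕ.+ denExp (m₂₁ S)))
          W = P^ t * P^ t * P^ n
          W₁₁ : P^ (denExp (m₁₁ S) ℕ.+ denExp (m₂₂ S)) ≡ W
          W₁₁ = trans (P^-den den₁₁ (den₁₂ t≤n)) (cong (_* P^ n) P^t+t)
          W₁₂ : P^ (denExp (m₁₂ S) ℕ.+ denExp (m₂₁ S)) ≡ W
          W₁₂ = trans (P^-den (den₁₂ t≤n) den₂₁) (trans (ℤP.*-comm (P^ n) _) (cong (_* P^ n) P^t+t))
          ring : ∀ Pt Pn y z G →
            Pt * Pt * Pn * (Pt * Pt) * (y * z * (Pn * G)) ≡ Pt * Pt * Pn * (Pt * Pt * Pn) * (y * z * G)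
          ring = solve-∀

      integral-first-column : t ≤ n → (∀ K → t ≤ K → P^ t ∣ c K) → IsIntegral p (m₁₁ S) × IsIntegral p (m₂₁ S)
      integral-first-column t≤n t∣c =
        IsIntegral-intro (m₁₁ S) den₁₁
          (subst₂ _∣_ (sym P^t+t) (sym (numer₁₁ (t ℕ.+ t))) (entry (ℕP.m≤m+n t t) (e _) (g _))) ,
        IsIntegral-intro (m₂₁ S) den₂₁
          (subst₂ _∣_ (sym P^t+t) (sym (numer₂₁ (t ℕ.+ t))) (entry (ℕP.m≤m+n t t) (h _) (f _)))
        where
          entry : ∀ {K} → t ≤ K → ∀ x₁ x₂ → P^ t * P^ t ∣ (x₁ * P^ n * a K - x₂ * c K) * y K * P^ t
          entry {K} t≤K x₁ x₂ = *-pres-∣ (∣m⇒∣m*n (y K) t∣s) ∣-refl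
            where t∣s = ∣m∣n⇒∣m-n (∣m⇒∣m*n (a K) (∣n⇒∣m*n x₁ (^ᶻ-mono-∣ (P p) t≤n))) (∣n⇒∣m*n x₂ (t∣c K t≤K))

      integral-second-column : t ≤ n → P^ n ∣ c n * X + d n * P^ t → IsIntegral p (m₁₂ S) × IsIntegral p (m₂₂ S)
      integral-second-column t≤n n∣cX+dPᵗ =
        IsIntegral-intro (m₁₂ S) (den₁₂ t≤n) (subst (P^ n ∣_) (sym (numer₁₂ n)) (∣m⇒∣m*n (z n) (entry (e n) (g n)))) ,
        IsIntegral-intro (m₂₂ S) (den₁₂ t≤n) (subst (P^ n ∣_) (sym (numer₂₂ n)) (∣m⇒∣m*n (z n) (entry (h n) (f n))))
        where
          ring : ∀ x₁ x₂ Pn a b c d X Pt →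
            (x₁ * Pn * a - x₂ * c) * X + (x₁ * Pn * b - x₂ * d) * Pt ≡ x₁ * Pn * (a * X + b * Pt) - x₂ * (c * X + d * Pt)
          ring = solve-∀
          entry : ∀ x₁ x₂ → P^ n ∣ (x₁ * P^ n * a n - x₂ * c n) * X + (x₁ * P^ n * b n - x₂ * d n) * P^ t
          entry x₁ x₂ = subst (P^ n ∣_) (sym (ring x₁ x₂ (P^ n) (a n) (b n) (c n) (d n) X (P^ t)))
            (∣m∣n⇒∣m-n (∣m⇒∣m*n (a n * X + b n * P^ t) (∣n⇒∣m*n x₁ ∣-refl)) (∣n⇒∣m*n x₂ n∣cX+dPᵗ))

      IsUnitq-det : t ≤ n → IsUnitₚ p (detₚ p γ) → IsUnitₚ p (detₚ p τ) → IsUnitₚ p y₁ → IsUnitₚ p y₂ →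
                    IsUnitq p (detq p S)
      IsUnitq-det t≤n unit-γ unit-τ unit-y₁ unit-y₂ =
        IsUnitq-intro (detq p S) (λ K → y K * z K * (seq (detₚ p γ) K * seq (detₚ p τ) K)) (numer-det t≤n)
          λ K 1≤K → IsUnitᶻ-* (IsUnitᶻ-* (IsUnitₚ⇒IsUnitᶻ y₁ unit-y₁ 1≤K) (IsUnitₚ⇒IsUnitᶻ y₂ unit-y₂ 1≤K))
                              (IsUnitᶻ-* (IsUnitₚ⇒IsUnitᶻ (detₚ p γ) unit-γ 1≤K) (IsUnitₚ⇒IsUnitᶻ (detₚ p τ) unit-τ 1≤K))

      ∣q-m₂₁ : ∀ j → p^_∣q_ p j (m₂₁ S) ⇔
               P^ (t ℕ.+ j) ∣ s₂₁ (denExp (m₂₁ S) ℕ.+ j) * y (denExp (m₂₁ S) ℕ.+ j)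
      ∣q-m₂₁ j = mk⇔ (λ j∣ → P^-cancelˡ-∣ t (subst₂ _∣_ P^-level numer-level (Equivalence.to (∣q⇔∣numer (m₂₁ S) j) j∣)))
                     (λ t+j∣ → Equivalence.from (∣q⇔∣numer (m₂₁ S) j)
                                 (subst₂ _∣_ (sym P^-level) (sym numer-level) (*-pres-∣ (∣-refl {P^ t}) t+j∣)))
        where
          P^-level : P^ (denExp (m₂₁ S) ℕ.+ j) ≡ P^ t * P^ (t ℕ.+ j)
          P^-level = trans (cong P^_ (trans (cong (ℕ._+ j) den₂₁) (ℕP.+-assoc t t j))) (^ᶻ-distribˡ-+-* (P p) t (t ℕ.+ j))
          numer-level : seq (numer (m₂₁ S)) (denExp (m₂₁ S) ℕ.+ j) ≡
                        P^ t * (s₂₁ (denExp (m₂₁ S) ℕ.+ j) * y (denExp (m₂₁ S) ℕ.+ j))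
          numer-level = trans (numer₂₁ (denExp (m₂₁ S) ℕ.+ j))
                              (ℤP.*-comm (s₂₁ (denExp (m₂₁ S) ℕ.+ j) * y (denExp (m₂₁ S) ℕ.+ j)) (P^ t))

      P^n∣s₂₁ : p^_∣ₚ_ p n (m₂₁ γ) → ∀ K → n ≤ K → P^ n ∣ s₂₁ K
      P^n∣s₂₁ n∣f K n≤K = ∣m∣n⇒∣m-n (∣m⇒∣m*n (a K) (∣n⇒∣m*n (h K) ∣-refl))
                                     (∣m⇒∣m*n (c K) (∣ₚ⇒∣seq (m₂₁ γ) n≤K n∣f))

      P^1+n∤s₂₁ : GL₂ℤₚ p γ → GL₂ℤₚ p τ → p^_∣ₚ_ p n (m₂₁ γ) → 1 ≤ n →
                  ∀ K → suc n ≤ K → P^ 1 ∣ c K → ¬ (P^ (suc n) ∣ s₂₁ K)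
      P^1+n∤s₂₁ unit-γ unit-τ n∣ₚf 1≤n K sn≤K P∣c sn∣s =
        IsUnitᶻ-* unit-h unit-a (P^-cancelˡ-∣ n (subst₂ _∣_ (P^suc n) (ring (h K) (P^ n) (a K) (f K) (c K)) sn∣ha))
        where
          1≤K = ℕP.≤-trans (s≤s z≤n) sn≤K
          n∣f : P^ n ∣ f K
          n∣f = ∣ₚ⇒∣seq (m₂₁ γ) (ℕP.≤-trans (ℕP.n≤1+n n) sn≤K) n∣ₚf
          ring : ∀ h Pn a f c → (h * Pn * a - f * c) + f * c ≡ Pn * (h * a)
          ring = solve-∀
          sn∣ha : P^ (suc n) ∣ (h K * P^ n * a K - f K * c K) + f K * c K
          sn∣ha = ∣m∣n⇒∣m+n sn∣s (subst (_∣ f K * c K) (sym (P^suc n)) (*-pres-∣ n∣f P∣c))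
          unit-h : IsUnitᶻ (h K)
          unit-h = proj₂ (IsUnitᶻ-det⇒IsUnitᶻ-diagonal {g K} {h K} {e K} (IsUnitₚ⇒IsUnitᶻ (detₚ p γ) unit-γ 1≤K)
                                                     (∣-trans (^ᶻ-mono-∣ (P p) 1≤n) n∣f))
          unit-a : IsUnitᶻ (a K)
          unit-a = proj₁ (IsUnitᶻ-det⇒IsUnitᶻ-diagonal {a K} {d K} {b K} (IsUnitₚ⇒IsUnitᶻ (detₚ p τ) unit-τ 1≤K) P∣c)

      cq-σ : t ≤ n → IsUnitₚ p y₁ → (∀ K → n ≤ K → P^ n ∣ s₂₁ K) →
             (1 ≤ t → ∀ K → suc n ≤ K → ¬ (P^ (suc n) ∣ s₂₁ K)) →
             cq p n (σ p n γ τ (ι p X /p^ cₚ p n τ) y₁ y₂) ≡ n ∸ cₚ p n τ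
      cq-σ t≤n unit-y₁ n∣s₂₁ ¬sn∣s₂₁ =
        cq-unique (σ p n γ τ (ι p X /p^ cₚ p n τ) y₁ y₂) n (n ∸ t) (ℕP.m∸n≤m n t)
          (subst (λ M → p^_∣q_ p (n ∸ t) (m₂₁ M)) S≡σ divisible-at-n∸t)
          (λ {k} r<k k≤n k∣ → not-divisible-above r<k k≤n (subst (λ M → p^_∣q_ p k (m₂₁ M)) (sym S≡σ) k∣))
        where
          t+n∸t : t ℕ.+ (n ∸ t) ≡ n
          t+n∸t = ℕP.m+[n∸m]≡n t≤n

          level-≥ : ∀ {i} j → t ℕ.+ j ≡ i → i ≤ denExp (m₂₁ S) ℕ.+ j
          level-≥ j refl = subst (t ℕ.+ j ≤_) (sym (trans (cong (ℕ._+ j) den₂₁) (ℕP.+-assoc t t j)))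
                                 (ℕP.m≤n+m (t ℕ.+ j) t)

          divisible-at-n∸t : p^_∣q_ p (n ∸ t) (m₂₁ S)
          divisible-at-n∸t = Equivalence.from (∣q-m₂₁ (n ∸ t))
            (subst (λ i → P^ i ∣ s₂₁ (denExp (m₂₁ S) ℕ.+ (n ∸ t)) * y (denExp (m₂₁ S) ℕ.+ (n ∸ t))) (sym t+n∸t)
              (∣m⇒∣m*n (y (denExp (m₂₁ S) ℕ.+ (n ∸ t)))
                (n∣s₂₁ (denExp (m₂₁ S) ℕ.+ (n ∸ t)) (level-≥ (n ∸ t) t+n∸t))))

          not-divisible-at : ∀ K → suc n ≤ K → 1 ≤ t → ¬ (P^ (suc n) ∣ s₂₁ K * y K)
          not-divisible-at K sn≤K 1≤t = valuation-*-IsUnitᶻ {n} (n∣s₂₁ K (ℕP.≤-trans (ℕP.n≤1+n n) sn≤K))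
            (¬sn∣s₂₁ 1≤t K sn≤K) (IsUnitₚ⇒IsUnitᶻ y₁ unit-y₁ (ℕP.≤-trans (s≤s z≤n) sn≤K))

          not-divisible-above : ∀ {k} → n ∸ t < k → k ≤ n → ¬ p^_∣q_ p k (m₂₁ S)
          not-divisible-above r<k k≤n k∣ =
            not-divisible-at (denExp (m₂₁ S) ℕ.+ suc (n ∸ t)) (level-≥ (suc (n ∸ t)) t+sr≡sn) 1≤t
              (subst (λ i → P^ i ∣ s₂₁ (denExp (m₂₁ S) ℕ.+ suc (n ∸ t)) * y (denExp (m₂₁ S) ℕ.+ suc (n ∸ t)))
                     t+sr≡sn (Equivalence.to (∣q-m₂₁ (suc (n ∸ t))) (∣q-downward (m₂₁ S) r<k k∣)))
            where
              t+sr≡sn : t ℕ.+ suc (n ∸ t) ≡ suc n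
              t+sr≡sn = trans (ℕP.+-suc t (n ∸ t)) (cong suc t+n∸t)
              1≤t : 1 ≤ t
              1≤t = ℕP.n≢0⇒n>0 (λ t≡0 → ℕP.<-irrefl (cong (n ∸_) t≡0) (ℕP.<-≤-trans r<k k≤n))

      σ-InGL₂ℤₚ : t ≤ n → (∀ K → t ≤ K → P^ t ∣ c K) → P^ n ∣ c n * X + d n * P^ t →
                  GL₂ℤₚ p γ → GL₂ℤₚ p τ → IsUnitₚ p y₁ → IsUnitₚ p y₂ →
                  InGL₂ℤₚ p (σ p n γ τ (ι p X /p^ cₚ p n τ) y₁ y₂)
      σ-InGL₂ℤₚ t≤n t∣c n∣cX+dPᵗ unit-γ unit-τ unit-y₁ unit-y₂ = subst (InGL₂ℤₚ p) S≡σ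
        (proj₁ first , proj₁ second , proj₂ first , proj₂ second , IsUnitq-det t≤n unit-γ unit-τ unit-y₁ unit-y₂)
        where
          first = integral-first-column t≤n t∣c
          second = integral-second-column t≤n n∣cX+dPᵗ

σ-integral-for-some-x : ∀ p → Prime p → (n : ℕ) → (τ : Mat (ℤₚ p)) → GL₂ℤₚ p τ → cₚ p n τ < n →
  Σ (ℚₚ p) (λ x →
    (y₁ y₂ : ℤₚ p) → IsUnitₚ p y₁ → IsUnitₚ p y₂ →
    (γ : Mat (ℤₚ p)) → K₀ p n γ →
      InGL₂ℤₚ p (σ p n γ τ x y₁ y₂) × cq p n (σ p n γ τ x y₁ y₂) ≡ n ∸ cₚ p n τ)
σ-integral-for-some-x p p-prime n τ unit-τ t<n = ι p X /p^ cₚ p n τ , properties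
  where
    X = proj₁ (linear-congruence-solvable p p-prime n τ t<n)
    n∣cX+dPᵗ = proj₂ (linear-congruence-solvable p p-prime n τ t<n)
    t≤n = ℕP.<⇒≤ t<n
    1≤n = ℕP.≤-trans (s≤s z≤n) t<n
    t∣c : ∀ K → cₚ p n τ ≤ K → P^_ p (cₚ p n τ) ∣ seq (m₂₁ τ) K
    t∣c _ = cₚ-divides p n τ
    properties : (y₁ y₂ : ℤₚ p) → IsUnitₚ p y₁ → IsUnitₚ p y₂ → (γ : Mat (ℤₚ p)) → K₀ p n γ →
      InGL₂ℤₚ p (σ p n γ τ (ι p X /p^ cₚ p n τ) y₁ y₂) × cq p n (σ p n γ τ (ι p X /p^ cₚ p n τ) y₁ y₂) ≡ n ∸ cₚ p n τ
    properties y₁ y₂ unit-y₁ unit-y₂ γ (unit-γ , n∣f) =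
      σ-InGL₂ℤₚ t≤n t∣c n∣cX+dPᵗ unit-γ unit-τ unit-y₁ unit-y₂ ,
      cq-σ t≤n unit-y₁ (P^n∣s₂₁ n∣f) (λ 1≤t K sn≤K → P^1+n∤s₂₁ unit-γ unit-τ n∣f 1≤n K sn≤K (P∣c 1≤t sn≤K))
      where
        open Twist p p-prime n γ τ X y₁ y₂
        P∣c : ∀ {K} → 1 ≤ t → suc n ≤ K → P^_ p 1 ∣ seq (m₂₁ τ) K
        P∣c 1≤t sn≤K = ∣-trans (^ᶻ-mono-∣ (P p) 1≤t) (t∣c _ (ℕP.≤-trans t≤n (ℕP.≤-trans (ℕP.n≤1+n n) sn≤K)))

0<m∸2n⇒n<m : ∀ {m n} → 0 < m ∸ 2 ℕ.* n → n < m
0<m∸2n⇒n<m {m} {n} 0<m∸2n =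
  ℕP.≤-<-trans (ℕP.m≤m+n n (n ℕ.+ 0)) (ℕP.m∸n≢0⇒n<m (λ m∸2n≡0 → ℕP.<-irrefl (sym m∸2n≡0) 0<m∸2n))

lemma2p5 : (N p : ℕ) → 0 < N → Prime p → p ∣ℕ N →
    (τ : Mat (ℤₚ p)) → GL₂ℤₚ p τ → 0 < wₚ p (vₚ p N) τ →
    Σ (ℚₚ p) (λ x →
      (y₁ y₂ : ℤₚ p) → IsUnitₚ p y₁ → IsUnitₚ p y₂ →
      (γ : Mat (ℤₚ p)) → K₀ p (vₚ p N) γ →
        InGL₂ℤₚ p (σ p (vₚ p N) γ τ x y₁ y₂)
        × cq p (vₚ p N) (σ p (vₚ p N) γ τ x y₁ y₂) ≡ vₚ p N ∸ cₚ p (vₚ p N) τ)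
-- Only c_p(τ) < n_p is needed.
lemma2p5 N p _ p-prime _ τ unit-τ 0<w = σ-integral-for-some-x p p-prime (vₚ p N) τ unit-τ (0<m∸2n⇒n<m 0<w)
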